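{- Let $k\ge 1$ and $n_1 \ge n_2 \ge \dots \ge n_k \ge 2$ be integers with $n_1 \ge 3$, let $n = n_1+\dots+n_k$, and let $\mathrm{P} = \mathrm{P}_{n_1}\,\Box\,\cdots\,\Box\,\mathrm{P}_{n_k}$. Then every maximal matching of $\mathrm{P}$ has cardinality at least \[ \frac{n-k}{3n-3k+1}\,|V(\mathrm{P})|. \]
   Context: The permutahedron $\mathrm{P}_m$ is the graph whose vertices are the permutations of $[m]$ in one-line notation, two permutations being adjacent if one is obtained from the other by swapping the entries at two consecutive positions. The Cartesian product $G\,\Box\,H$ of graphs $G,H$ has vertex set $V(G)\times V(H)$, with $(u,v)$ adjacent to $(u',v')$ iff either $u=u'$ and $vv'\in E(H)$, or $v=v'$ and $uu'\in E(G)$. A maximal matching is a set of pairwise vertex-disjoint edges that is maximal with respect to inclusion. -}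

module Defs where

open import Data.Nat using (ℕ; _≤_)
open import Data.Fin using (Fin; toℕ)
open import Data.Vec using (Vec; lookup; _[_]≔_)
open import Data.List using (List; []; _∷_)
open import Data.List.Relation.Unary.All using (All; []; _∷_)
open import Data.List.Relation.Unary.AllPairs using (AllPairs)
open import Data.List.Relation.Unary.All using () renaming (All to AllL)
open import Data.Product using (Σ; _×_; _,_; ∃)
open import Data.Sum using (_⊎_)
open import Data.Empty using (⊥)
open import Relation.Binary.PropositionalEquality using (_≡_; _≢_)
open import Relation.Nullary using (¬_)

-- A word of length m over [m] = Fin m, in one-line notation.
Word : ℕ → Set
Word m = Vec (Fin m) m

IsPerm : ∀ {m} → Word m → Set
IsPerm {m} v = ∀ (i j : Fin m) → lookup v i ≡ lookup v j → i ≡ j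

-- Adjacency in the permutahedron P_m: w is v with the entries at two
-- consecutive positions i, i+1 swapped.
PermAdj : ∀ {m} → Word m → Word m → Set
PermAdj {m} v w =
  Σ (Fin m) λ i → Σ (Fin m) λ j →
    (toℕ j ≡ Data.Nat.suc (toℕ i)) ×
    (w ≡ (v [ i ]≔ lookup v j) [ j ]≔ lookup v i)

-- Vertices of P_{n_1} □ ... □ P_{n_k} for ns = n_1 ∷ ... ∷ n_k:
-- tuples of words, each of which is a permutation.
Tuple : List ℕ → Set
Tuple ns = All Word ns

IsVertex : ∀ {ns} → Tuple ns → Set
IsVertex [] = Data.Unit.⊤ where import Data.Unit
IsVertex (v ∷ vs) = IsPerm v × IsVertex vs

ProdAdj : ∀ {ns} → Tuple ns → Tuple ns → Set
ProdAdj [] [] = ⊥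
ProdAdj (u ∷ us) (u' ∷ us') =
  (u ≡ u' × ProdAdj us us') ⊎ (us ≡ us' × PermAdj u u')

IsEdge : ∀ {ns} → Tuple ns → Tuple ns → Set
IsEdge a b = IsVertex a × IsVertex b × ProdAdj a b

Edge : List ℕ → Set
Edge ns = Tuple ns × Tuple ns

Disjoint : ∀ {ns} → Edge ns → Edge ns → Set
Disjoint (a , b) (c , d) = a ≢ c × a ≢ d × b ≢ c × b ≢ d

-- A matching: a list of edges of the graph, pairwise vertex-disjoint
-- (in particular without repetitions, so its length is its cardinality).
IsMatching : ∀ {ns} → List (Edge ns) → Set
IsMatching M = AllL (λ e → IsEdge (Data.Product.proj₁ e) (Data.Product.proj₂ e)) M
             × AllPairs Disjoint M

IsMaximalMatching : ∀ {ns} → List (Edge ns) → Set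
IsMaximalMatching {ns} M =
  IsMatching M ×
  (∀ (a b : Tuple ns) → IsEdge a b → ¬ IsMatching ((a , b) ∷ M))

{-# OPTIONS --safe #-}
-- A vertex v has one neighbour v · t for each of the d = n − k adjacent transpositions t of
-- the factors, giving d |V| pairs (v , t).  Each pair is charged to an edge {x , y = x · s} of
-- the maximal matching M together with one of 3d + 1 labels, from which the pair can be
-- recovered.  If v = x or v = y, the label is "at x, t" or "at y, t".  Otherwise v is unmatched,
-- so by maximality its neighbour v · t is matched.  If v · t = x, the label is "near x, t"; then
-- x · t = v is unmatched.  If v · t = y then t ≠ s; if t commutes with s, then x · t = v · s is a
-- neighbour of v, hence matched, which tells this case apart from the previous one, so the label
-- is again "near x, t".  Otherwise t is one of the two transpositions adjacent to s, labelled
-- "near x, s" (free, since x · s = y is matched) and one extra label.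
module Submission where

open import Defs
open import Data.Nat using (ℕ; _+_; _*_; _∸_; _≤_)
open import Data.Nat using (_!)
open import Data.List using (List; _∷_; length; map)
open import Data.Nat.ListAction using (sum; product)
open import Data.List.Relation.Unary.All using (All)
open import Data.List.Relation.Unary.Linked using (Linked)
open import Data.Nat using (_≥_)

open import Data.Bool using (if_then_else_)
open import Data.Empty using (⊥-elim)
open import Data.Fin as Fin using (Fin; zero; suc; toℕ; inject₁; punchIn; remQuot)
open import Data.Fin.Permutation using (transpose; _⟨$⟩ʳ_; lift₀-transpose)
open import Data.Fin.Properties
  using (toℕ-inject₁; toℕ-injective; punchIn-injective; punchInᵢ≢i; *↔×; +↔⊎; 0↔⊥; 1↔⊤; injective⇒≤)
open import Data.List as List using ([])
open import Data.List.Membership.Propositional.Properties using (∈-lookup)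
open import Data.List.Relation.Unary.All as All using ([]; _∷_)
open import Data.List.Relation.Unary.AllPairs using (_∷_)
open import Data.List.Relation.Unary.Any as Any using (Any; here; there)
open import Data.List.Relation.Unary.Any.Properties using (there-injective; ⊥↔Any[]; ∷↔; lookup-index)
open import Data.Nat using (zero; suc; pred; _<_; s≤s; z≤n)
open import Data.Nat.Properties using (<-cmp; m≤n⇒m<n∨m≡n; suc-injective; ≤-trans; +-suc; +-assoc; m+n∸n≡m)
open import Data.Product using (∃; _×_; _,_; proj₁; proj₂)
open import Data.Product.Function.NonDependent.Propositional using (_×-↔_)
open import Data.Product.Properties using (×-≡,≡→≡)
open import Data.Sum using (_⊎_; inj₁; inj₂)
open import Data.Sum.Function.Propositional using (_⊎-↔_)
open import Data.Unit using (⊤; tt)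
open import Data.Vec as Vec using (Vec; []; _∷_; lookup; _[_]≔_)
open import Data.Vec.Properties using (∷-injective; ∷-injectiveˡ; lookup-map; ≡-dec)
open import Function using (_∘_; Injective; Injection; _↔_; _↣_; mk↣)
open import Function.Construct.Composition using (_↔-∘_; _↣-∘_)
open import Function.Properties.Inverse using (↔⇒↣; ↔-sym; ↔-refl)
open import Relation.Binary.Definitions using (DecidableEquality; tri<; tri≈; tri>)
open import Relation.Binary.PropositionalEquality
open import Relation.Nullary using (¬_)
open import Relation.Nullary.Decidable as Dec
  using (Dec; does; yes; no; dec-true; dec-false; _×-dec_; _⊎-dec_; via-injection; decidable-stable)

private variable
  A : Set
  m : ℕ
  ns : List ℕ

swapAt : Vec A (suc m) → Fin m → Vec A (suc m)
swapAt (x ∷ v)     (suc p) = x ∷ swapAt v p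
swapAt (x ∷ y ∷ v) zero    = y ∷ x ∷ v

swapAt-involutive : (v : Vec A (suc m)) (p : Fin m) → swapAt (swapAt v p) p ≡ v
swapAt-involutive (x ∷ y ∷ v) zero    = refl
swapAt-involutive (x ∷ v)     (suc p) = cong (x ∷_) (swapAt-involutive v p)

swapAt-comm : (v : Vec A (suc m)) (p q : Fin m) → suc (toℕ p) < toℕ q →
              swapAt (swapAt v p) q ≡ swapAt (swapAt v q) p
swapAt-comm (x ∷ y ∷ v) zero    (suc zero)    (s≤s ())
swapAt-comm (x ∷ y ∷ v) zero    (suc (suc q)) _         = refl
swapAt-comm (x ∷ v)     (suc p) (suc q)       (s≤s p<q) = cong (x ∷_) (swapAt-comm v p q p<q)

swapAt-as-updates : (v : Vec A (suc m)) (p : Fin m) →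
                    swapAt v p ≡ (v [ inject₁ p ]≔ lookup v (suc p)) [ suc p ]≔ lookup v (inject₁ p)
swapAt-as-updates (x ∷ y ∷ v) zero    = refl
swapAt-as-updates (x ∷ v)     (suc p) = cong (x ∷_) (swapAt-as-updates v p)

lookup-swapAt : (v : Vec A (suc m)) (p : Fin m) (k : Fin (suc m)) →
                lookup (swapAt v p) k ≡ lookup v (transpose (inject₁ p) (suc p) ⟨$⟩ʳ k)
lookup-swapAt (x ∷ y ∷ v) zero    zero          = refl
lookup-swapAt (x ∷ y ∷ v) zero    (suc zero)    = refl
lookup-swapAt (x ∷ y ∷ v) zero    (suc (suc k)) = refl
lookup-swapAt (x ∷ v)     (suc p) zero          = refl
lookup-swapAt (x ∷ v)     (suc p) (suc k)       =
  trans (lookup-swapAt v p k) (cong (lookup (x ∷ v)) (sym (lift₀-transpose (inject₁ p) (suc p) (suc k))))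

swapAt-isPerm : (v : Word (suc m)) (p : Fin m) → IsPerm v → IsPerm (swapAt v p)
swapAt-isPerm v p perm k l eq = Injection.injective (↔⇒↣ (transpose (inject₁ p) (suc p)))
  (perm _ _ (trans (sym (lookup-swapAt v p k)) (trans eq (lookup-swapAt v p l))))

map-injective : ∀ {B : Set} {f : A → B} → Injective _≡_ _≡_ f → Injective _≡_ _≡_ (Vec.map {n = m} f)
map-injective f-inj {[]}    {[]}    _  = refl
map-injective f-inj {x ∷ u} {y ∷ v} eq =
  cong₂ _∷_ (f-inj (∷-injectiveˡ eq)) (map-injective f-inj (proj₂ (∷-injective eq)))

remQuot-injective : ∀ {n} k → Injective _≡_ _≡_ (remQuot {n} k)
remQuot-injective k = Injection.injective (↔⇒↣ *↔×)

insert-injective : ∀ {k k′ : Fin (suc m)} {u v : Vec (Fin m) m} →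
                   k ∷ Vec.map (punchIn k) u ≡ k′ ∷ Vec.map (punchIn k′) v → k ≡ k′ × u ≡ v
insert-injective eq with ∷-injective eq
... | refl , tail≡ = refl , map-injective (punchIn-injective _ _ _) tail≡

insert-isPerm : (k : Fin (suc m)) (u : Word m) → IsPerm u → IsPerm (k ∷ Vec.map (punchIn k) u)
insert-isPerm k u perm zero    zero    _  = refl
insert-isPerm k u perm zero    (suc j) eq = ⊥-elim (punchInᵢ≢i k (lookup u j) (sym (trans eq (lookup-map j (punchIn k) u))))
insert-isPerm k u perm (suc i) zero    eq = ⊥-elim (punchInᵢ≢i k (lookup u i) (trans (sym (lookup-map i (punchIn k) u)) eq))
insert-isPerm k u perm (suc i) (suc j) eq = cong suc (perm i j (punchIn-injective k _ _
  (trans (sym (lookup-map i (punchIn k) u)) (trans eq (lookup-map j (punchIn k) u)))))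

permutationAt : ∀ m → Fin (m !) → Word m
permutationAt zero    _ = []
permutationAt (suc m) c = let (k , d) = remQuot (m !) c in k ∷ Vec.map (punchIn k) (permutationAt m d)

permutationAt-injective : ∀ m → Injective _≡_ _≡_ (permutationAt m)
permutationAt-injective zero    {zero} {zero} _ = refl
permutationAt-injective (suc m) eq =
  let (k≡k′ , d≡d′) = insert-injective eq
  in  remQuot-injective (m !) (×-≡,≡→≡ (k≡k′ , permutationAt-injective m d≡d′))

permutationAt-isPerm : ∀ m (c : Fin (m !)) → IsPerm (permutationAt m c)
permutationAt-isPerm zero    _ ()
permutationAt-isPerm (suc m) c = insert-isPerm _ _ (permutationAt-isPerm m _)

vertexAt : ∀ ns → Fin (product (map _! ns)) → Tuple ns
vertexAt []       _ = []
vertexAt (m ∷ ms) c = let (a , b) = remQuot (product (map _! ms)) c in permutationAt m a ∷ vertexAt ms b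

vertexAt-injective : ∀ ns → Injective _≡_ _≡_ (vertexAt ns)
vertexAt-injective []       {zero} {zero} _ = refl
vertexAt-injective (m ∷ ms) eq = remQuot-injective _ (×-≡,≡→≡
  (permutationAt-injective m (cong All.head eq) , vertexAt-injective ms (cong All.tail eq)))

vertexAt-isVertex : ∀ ns (c : Fin (product (map _! ns))) → IsVertex (vertexAt ns c)
vertexAt-isVertex []       _ = _
vertexAt-isVertex (m ∷ ms) c = permutationAt-isPerm m _ , vertexAt-isVertex ms _

swapAt-permAdj : (v : Word (suc m)) (p : Fin m) → PermAdj v (swapAt v p)
swapAt-permAdj v p = inject₁ p , suc p , cong suc (sym (toℕ-inject₁ p)) , swapAt-as-updates v p

permAdj⇒swapAt : {v w : Word (suc m)} → PermAdj v w → ∃ λ p → w ≡ swapAt v p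
permAdj⇒swapAt {v = v} (i , suc p , j≡1+i , refl)
  with toℕ-injective {i = i} {inject₁ p} (trans (sym (suc-injective j≡1+i)) (sym (toℕ-inject₁ p)))
... | refl = p , sym (swapAt-as-updates v p)

Gen : List ℕ → Set
Gen = Any (λ m → Fin (pred m))

infixl 7 _·_
_·_ : Tuple ns → Gen ns → Tuple ns
(v ∷ vs) · there t = v ∷ (vs · t)
_·_ {suc m ∷ _} (v ∷ vs) (here p) = swapAt v p ∷ vs

·-involutive : (v : Tuple ns) (t : Gen ns) → v · t · t ≡ v
·-involutive {suc m ∷ _} (v ∷ vs) (here p)  = cong (_∷ vs) (swapAt-involutive v p)
·-involutive             (v ∷ vs) (there t) = cong (v ∷_) (·-involutive vs t)

·-transpose : {v w : Tuple ns} {t : Gen ns} → v · t ≡ w → w · t ≡ v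
·-transpose {v = v} {t = t} refl = ·-involutive v t

·-isVertex : (v : Tuple ns) (t : Gen ns) → IsVertex v → IsVertex (v · t)
·-isVertex {suc m ∷ _} (v ∷ vs) (here p)  (v-perm , vs-vertex) = swapAt-isPerm v p v-perm , vs-vertex
·-isVertex             (v ∷ vs) (there t) (v-perm , vs-vertex) = v-perm , ·-isVertex vs t vs-vertex

·-adjacent : (v : Tuple ns) (t : Gen ns) → ProdAdj v (v · t)
·-adjacent {suc m ∷ _} (v ∷ vs) (here p)  = inj₂ (refl , swapAt-permAdj v p)
·-adjacent             (v ∷ vs) (there t) = inj₁ (refl , ·-adjacent vs t)

adjacent⇒· : (v w : Tuple ns) → ProdAdj v w → ∃ λ t → w ≡ v · t
adjacent⇒· [] [] ()
adjacent⇒· (v ∷ vs) (_ ∷ ws) (inj₁ (refl , adj)) = let (t , eq) = adjacent⇒· vs ws adj in there t , cong (v ∷_) eq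
adjacent⇒· {suc m ∷ _} (v ∷ vs) (_ ∷ _) (inj₂ (refl , adj)) = let (p , eq) = permAdj⇒swapAt adj in here p , cong (_∷ vs) eq

-- Like Fin.pred, a junk value at the boundary: the greatest element is its own successor.
next : Fin m → Fin m
next {suc zero}    zero    = zero
next {suc (suc m)} zero    = suc zero
next {suc (suc m)} (suc p) = suc (next p)

suc-toℕ⇒≡next : {p q : Fin m} → suc (toℕ p) ≡ toℕ q → q ≡ next p
suc-toℕ⇒≡next {suc (suc m)} {zero}  {suc zero} _  = refl
suc-toℕ⇒≡next {suc (suc m)} {suc p} {suc q}    eq = cong suc (suc-toℕ⇒≡next (suc-injective eq))

suc-toℕ⇒≡pred : {p q : Fin m} → suc (toℕ q) ≡ toℕ p → q ≡ Fin.pred p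
suc-toℕ⇒≡pred {p = suc p} eq = toℕ-injective (trans (suc-injective eq) (sym (toℕ-inject₁ p)))

prevGen nextGen : Gen ns → Gen ns
prevGen = Any.map Fin.pred
nextGen = Any.map next

data Interaction {ns} (s t : Gen ns) : Set where
  same      : t ≡ s → Interaction s t
  commuting : t ≢ s → (∀ v → v · s · t ≡ v · t · s) → Interaction s t
  isPrev    : t ≡ prevGen s → Interaction s t
  isNext    : t ≡ nextGen s → Interaction s t

there-interaction : {s t : Gen ns} → Interaction s t → Interaction (there {x = m} s) (there t)
there-interaction (same t≡s)           = same (cong there t≡s)
there-interaction (commuting t≢s comm) = commuting (t≢s ∘ there-injective) λ { (v ∷ vs) → cong (v ∷_) (comm vs) }
there-interaction (isPrev t≡prev)      = isPrev (cong there t≡prev)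
there-interaction (isNext t≡next)      = isNext (cong there t≡next)

here-interaction : (p q : Fin m) → Interaction {suc m ∷ ns} (here p) (here q)
here-interaction p q with <-cmp (toℕ p) (toℕ q)
... | tri≈ _ p≡q _ = same (cong here (toℕ-injective (sym p≡q)))
... | tri< p<q p≢q _ with m≤n⇒m<n∨m≡n p<q
...   | inj₁ 1+p<q = commuting (λ { refl → p≢q refl }) λ { (v ∷ vs) → cong (_∷ vs) (swapAt-comm v p q 1+p<q) }
...   | inj₂ 1+p≡q = isNext (cong here (suc-toℕ⇒≡next 1+p≡q))
here-interaction p q | tri> _ p≢q q<p with m≤n⇒m<n∨m≡n q<p
...   | inj₁ 1+q<p = commuting (λ { refl → p≢q refl }) λ { (v ∷ vs) → cong (_∷ vs) (sym (swapAt-comm v q p 1+q<p)) }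
...   | inj₂ 1+q≡p = isPrev (cong here (suc-toℕ⇒≡pred 1+q≡p))

interaction : (s t : Gen ns) → Interaction s t
interaction             (there s) (there t) = there-interaction (interaction s t)
interaction {suc m ∷ _} (here p)  (here q)  = here-interaction p q
interaction {suc m ∷ _} (here p)  (there t) = commuting (λ ()) λ { (v ∷ vs) → refl }
interaction {suc m ∷ _} (there s) (here q)  = commuting (λ ()) λ { (v ∷ vs) → refl }

tuple-≟ : DecidableEquality (Tuple ns)
tuple-≟ []       []       = yes refl
tuple-≟ (u ∷ us) (v ∷ vs) =
  Dec.map′ (λ (u≡v , us≡vs) → cong₂ _∷_ u≡v us≡vs) (λ { refl → refl , refl })
           (≡-dec Fin._≟_ u v ×-dec tuple-≟ us vs)

⊎↔Fin : ∀ {B : Set} {a b} → A ↔ Fin a → B ↔ Fin b → (A ⊎ B) ↔ Fin (a + b)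
⊎↔Fin f g = ↔-sym +↔⊎ ↔-∘ (f ⊎-↔ g)

×↔Fin : ∀ {B : Set} {a b} → A ↔ Fin a → B ↔ Fin b → (A × B) ↔ Fin (a * b)
×↔Fin f g = ↔-sym *↔× ↔-∘ (f ×-↔ g)

Gen↔Fin : ∀ ns → Gen ns ↔ Fin (sum (map pred ns))
Gen↔Fin []       = ↔-sym 0↔⊥ ↔-∘ ↔-sym ⊥↔Any[]
Gen↔Fin (m ∷ ms) = ⊎↔Fin ↔-refl (Gen↔Fin ms) ↔-∘ ↔-sym (∷↔ _)

gen-≟ : DecidableEquality (Gen ns)
gen-≟ = via-injection (↔⇒↣ (Gen↔Fin _)) Fin._≟_

≤-by-injection : ∀ {B : Set} {a b} → A ↔ Fin a → B ↔ Fin b → A ↣ B → a ≤ b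
≤-by-injection f g h = injective⇒≤ (Injection.injective (↔⇒↣ g ↣-∘ (h ↣-∘ ↔⇒↣ (↔-sym f))))

Endpoint : Tuple ns → Edge ns → Set
Endpoint v e = v ≡ proj₁ e ⊎ v ≡ proj₂ e

unmatched⇒disjoint : {a b : Tuple ns} (L : List (Edge ns)) →
                     ¬ Any (Endpoint a) L → ¬ Any (Endpoint b) L → All (Disjoint (a , b)) L
unmatched⇒disjoint []      _     _     = []
unmatched⇒disjoint (_ ∷ L) a-free b-free =
  (a-free ∘ here ∘ inj₁ , a-free ∘ here ∘ inj₂ , b-free ∘ here ∘ inj₁ , b-free ∘ here ∘ inj₂)
  ∷ unmatched⇒disjoint L (a-free ∘ there) (b-free ∘ there)

-- Fin 3 × Gen ns ⊎ ⊤ rather than a four-constructor type, so that it has 3 d + 1 elements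
-- on the nose.
Label : List ℕ → Set
Label ns = Fin 3 × Gen ns ⊎ ⊤

pattern atX t   = inj₁ (zero , t)
pattern atY t   = inj₁ (suc zero , t)
pattern nearX t = inj₁ (suc (suc zero) , t)
pattern nextY   = inj₂ tt

Label↔Fin : ∀ ns → Label ns ↔ Fin (3 * sum (map pred ns) + 1)
Label↔Fin ns = ⊎↔Fin (×↔Fin ↔-refl (Gen↔Fin ns)) (↔-sym 1↔⊤)

module Charging {ns} (M : List (Edge ns)) (maximal : IsMaximalMatching M) where

  Matched : Tuple ns → Set
  Matched v = Any (Endpoint v) M

  matched? : (v : Tuple ns) → Dec (Matched v)
  matched? v = Any.any? (λ e → tuple-≟ v (proj₁ e) ⊎-dec tuple-≟ v (proj₂ e)) M

  neighbour-matched : {v : Tuple ns} → IsVertex v → ¬ Matched v → ∀ t → Matched (v · t)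
  neighbour-matched {v} v-vertex v-free t = decidable-stable (matched? (v · t)) λ vt-free →
    let edge = v-vertex , ·-isVertex v t v-vertex , ·-adjacent v t
        (edges , disjoint) = proj₁ maximal
    in  proj₂ maximal v (v · t) edge (edge ∷ edges , unmatched⇒disjoint M v-free vt-free ∷ disjoint)

  x y : Fin (length M) → Tuple ns
  x i = proj₁ (List.lookup M i)
  y i = proj₂ (List.lookup M i)

  x-matched : ∀ i → Matched (x i)
  x-matched i = Any.map (inj₁ ∘ cong proj₁) (∈-lookup i)
  y-matched : ∀ i → Matched (y i)
  y-matched i = Any.map (inj₂ ∘ cong proj₂) (∈-lookup i)

  generator : ∀ i → ∃ λ t → y i ≡ x i · t
  generator i =
    adjacent⇒· (x i) (y i) (proj₂ (proj₂ (All.lookup (proj₁ (proj₁ maximal)) (∈-lookup i))))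

  s : Fin (length M) → Gen ns
  s i = proj₁ (generator i)

  y≡x·s : ∀ i → y i ≡ x i · s i
  y≡x·s i = proj₂ (generator i)

  decode : Label ns × Fin (length M) → Tuple ns × Gen ns
  decode (atX t , i)   = x i , t
  decode (atY t , i)   = y i , t
  decode (nearX t , i) =
    if does (gen-≟ t (s i)) then (y i · prevGen (s i) , prevGen (s i))
    else if does (matched? (x i · t)) then (y i · t , t)
    else (x i · t , t)
  decode (nextY , i)   = y i · nextGen (s i) , nextGen (s i)

  decode-nearX-s : ∀ i → decode (nearX (s i) , i) ≡ (y i · prevGen (s i) , prevGen (s i))
  decode-nearX-s i rewrite dec-true (gen-≟ (s i) (s i)) refl = refl

  decode-nearX-matched : ∀ {t} i → t ≢ s i → Matched (x i · t) → decode (nearX t , i) ≡ (y i · t , t)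
  decode-nearX-matched {t} i t≢s xt-matched
    rewrite dec-false (gen-≟ t (s i)) t≢s | dec-true (matched? (x i · t)) xt-matched = refl

  decode-nearX-free : ∀ {t} i → t ≢ s i → ¬ Matched (x i · t) → decode (nearX t , i) ≡ (x i · t , t)
  decode-nearX-free {t} i t≢s xt-free
    rewrite dec-false (gen-≟ t (s i)) t≢s | dec-false (matched? (x i · t)) xt-free = refl

  Charge : Tuple ns → Gen ns → Set
  Charge v t = ∃ λ c → decode c ≡ (v , t)

  matched-charge : {v : Tuple ns} → Matched v → ∀ t → Charge v t
  matched-charge v-matched t with lookup-index v-matched
  ... | inj₁ v≡x = (atX t , Any.index v-matched) , cong (_, t) (sym v≡x)
  ... | inj₂ v≡y = (atY t , Any.index v-matched) , cong (_, t) (sym v≡y)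

  near-x-charge : {v : Tuple ns} {t : Gen ns} → ¬ Matched v → ∀ i → v · t ≡ x i → Charge v t
  near-x-charge {v} {t} v-free i vt≡x =
    (nearX t , i) , trans (decode-nearX-free i t≢s (v-free ∘ subst Matched x·t≡v)) (cong (_, t) x·t≡v)
    where
    x·t≡v : x i · t ≡ v
    x·t≡v = ·-transpose vt≡x
    t≢s : t ≢ s i
    t≢s refl = v-free (subst Matched (trans (y≡x·s i) x·t≡v) (y-matched i))

  near-y-charge : {v : Tuple ns} {t : Gen ns} → IsVertex v → ¬ Matched v → ∀ i → v · t ≡ y i → Charge v t
  near-y-charge {v} {t} v-vertex v-free i vt≡y with interaction (s i) t | ·-transpose vt≡y
  ... | same refl | y·t≡v =
    ⊥-elim (v-free (subst Matched (trans (sym (·-transpose (sym (y≡x·s i)))) y·t≡v) (x-matched i)))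
  ... | commuting t≢s comm | y·t≡v =
    (nearX t , i) , trans (decode-nearX-matched i t≢s xt-matched) (cong (_, t) y·t≡v)
    where
    x·t·s≡v : x i · t · s i ≡ v
    x·t·s≡v = trans (sym (comm (x i))) (trans (cong (_· t) (sym (y≡x·s i))) y·t≡v)
    xt-matched : Matched (x i · t)
    xt-matched = subst Matched (·-transpose x·t·s≡v) (neighbour-matched v-vertex v-free (s i))
  ... | isPrev refl | y·t≡v = (nearX (s i) , i) , trans (decode-nearX-s i) (cong (_, t) y·t≡v)
  ... | isNext refl | y·t≡v = (nextY , i) , cong (_, t) y·t≡v

  charge : ∀ v → IsVertex v → ∀ t → Charge v t
  charge v v-vertex t with matched? v
  ... | yes v-matched = matched-charge v-matched t
  ... | no  v-free    with neighbour-matched v-vertex v-free t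
  ...   | vt-matched with lookup-index vt-matched
  ...     | inj₁ vt≡x = near-x-charge v-free _ vt≡x
  ...     | inj₂ vt≡y = near-y-charge v-vertex v-free _ vt≡y

  charging : (Gen ns × Fin (product (map _! ns))) ↣ (Label ns × Fin (length M))
  charging = mk↣ injective
    where
    charge-at : (p : Gen ns × Fin (product (map _! ns))) → Charge (vertexAt ns (proj₂ p)) (proj₁ p)
    charge-at (t , a) = charge (vertexAt ns a) (vertexAt-isVertex ns a) t
    injective : Injective _≡_ _≡_ (proj₁ ∘ charge-at)
    injective {t , a} {t′ , a′} eq =
      let decoded≡ = trans (sym (proj₂ (charge-at (t , a)))) (trans (cong decode eq) (proj₂ (charge-at (t′ , a′))))
      in  ×-≡,≡→≡ (cong proj₂ decoded≡ , vertexAt-injective ns (cong proj₁ decoded≡))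

  charging-bound : sum (map pred ns) * product (map _! ns) ≤ (3 * sum (map pred ns) + 1) * length M
  charging-bound = ≤-by-injection (×↔Fin (Gen↔Fin ns) ↔-refl) (×↔Fin (Label↔Fin ns) ↔-refl) charging

sum-∸-length : ∀ {ns} → All (1 ≤_) ns → sum ns ∸ length ns ≡ sum (map pred ns)
sum-∸-length {ns} positive = begin
  sum ns ∸ length ns                              ≡⟨ cong (_∸ length ns) (sym (sum-pred+length positive)) ⟩
  sum (map pred ns) + length ns ∸ length ns       ≡⟨ m+n∸n≡m (sum (map pred ns)) (length ns) ⟩
  sum (map pred ns)                               ∎
  where
  open ≡-Reasoning
  sum-pred+length : ∀ {ns} → All (1 ≤_) ns → sum (map pred ns) + length ns ≡ sum ns
  sum-pred+length [] = refl
  sum-pred+length {suc m ∷ ms} (_ ∷ positive) = begin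
    m + sum (map pred ms) + suc (length ms)   ≡⟨ +-suc _ (length ms) ⟩
    suc (m + sum (map pred ms) + length ms)   ≡⟨ cong suc (+-assoc m _ _) ⟩
    suc (m + (sum (map pred ms) + length ms)) ≡⟨ cong (λ k → suc (m + k)) (sum-pred+length positive) ⟩
    suc (m + sum ms)                          ∎

proposition6p2 : (n₁ : ℕ) (rest : List ℕ) →
    3 ≤ n₁ →
    Linked _≥_ (n₁ ∷ rest) →
    All (2 ≤_) rest →
    (M : List (Edge (n₁ ∷ rest))) →
    IsMaximalMatching M →
    (sum (n₁ ∷ rest) ∸ length (n₁ ∷ rest)) * product (map _! (n₁ ∷ rest))
      ≤ (3 * (sum (n₁ ∷ rest) ∸ length (n₁ ∷ rest)) + 1) * length M
proposition6p2 n₁ rest 3≤n₁ _ 2≤rest M maximal =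
  subst (λ d → d * product (map _! (n₁ ∷ rest)) ≤ (3 * d + 1) * length M)
        (sym (sum-∸-length (≤-trans (s≤s z≤n) 3≤n₁ ∷ All.map (≤-trans (s≤s z≤n)) 2≤rest)))
        (Charging.charging-bound M maximal)
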